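{- Let $n,m\ge 0$ be integers, $S\subseteq[0..n-1]\times[0..m-1]$, $G=\mathsf{AG}^{n,m}(S)$, and let $p=(x,y)$, $p'=(x',y')$ be vertices of $G$. Then: (1) if $x\le x'$ and $y\le y'$, then $\mathrm{dist}_G(p,p')=|x'-x|+|y'-y|-2\,\mathsf{LIS}(S\cap([x..x')\times[y..y')))$; (2) if $x\le x'$ and $y\ge y'$, then $\mathrm{dist}_G(p,p')=|x'-x|+|y'-y|$; (3) if $x\ge x'$ and $y\le y'$, then $\mathrm{dist}_G(p,p')=|x'-x|+|y'-y|$; (4) if $x\ge x'$ and $y\ge y'$, then $\mathrm{dist}_G(p,p')=|x'-x|+|y'-y|-2\,\mathsf{LIS}(S\cap([x'..x)\times[y'..y)))$.
   Context: $[a..b]$ and $[a..b)$ denote integer intervals. The grid $\mathcal{G}^{n,m}=[0..n]\times[0..m]$. For $S\subseteq\mathcal{G}^{n-1,m-1}$, the alignment graph $\mathsf{AG}^{n,m}(S)$ is the undirected weighted graph on vertex set $\mathcal{G}^{n,m}$ with edges $(x,y)$--$(x+1,y)$ of weight $1$ for $(x,y)\in\mathcal{G}^{n-1,m}$, edges $(x,y)$--$(x,y+1)$ of weight $1$ for $(x,y)\in\mathcal{G}^{n,m-1}$, and edges $(x,y)$--$(x+1,y+1)$ of weight $0$ for $(x,y)\in S$; $\mathrm{dist}_G$ is its shortest-path distance. Define the strict partial order $(x,y)\prec(x',y')$ iff $x<x'$ and $y<y'$. A chain is a set whose distinct elements are pairwise comparable under $\prec$; $\mathsf{LIS}(T)$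 is the maximum size of a chain contained in $T$ ($\mathsf{LIS}(\emptyset)=0$). -}

module Defs where

open import Data.Nat using (ℕ; zero; suc; _+_; _≤_; _<_)
open import Data.Bool using (Bool; true)
open import Data.Product using (_×_; _,_; Σ; Σ-syntax)
open import Data.Sum using (_⊎_)
open import Data.List using (List; length)
open import Data.List.Relation.Unary.All using (All)
open import Data.List.Relation.Unary.AllPairs using (AllPairs)
open import Relation.Binary.PropositionalEquality using (_≡_)

Point : Set
Point = ℕ × ℕ

SubsetPts : Set
SubsetPts = ℕ → ℕ → Bool

data Edge (n m : ℕ) (S : SubsetPts) : Point → Point → ℕ → Set where
  horiz : ∀ {x y} → x < n → y ≤ m → Edge n m S (x , y) (suc x , y) 1
  vert  : ∀ {x y} → x ≤ n → y < m → Edge n m S (x , y) (x , suc y) 1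
  diag  : ∀ {x y} → x < n → y < m → S x y ≡ true →
          Edge n m S (x , y) (suc x , suc y) 0

data Adj (n m : ℕ) (S : SubsetPts) (u v : Point) (w : ℕ) : Set where
  fwd : Edge n m S u v w → Adj n m S u v w
  bwd : Edge n m S v u w → Adj n m S u v w

data Walk (n m : ℕ) (S : SubsetPts) : Point → Point → ℕ → Set where
  []  : ∀ {u} → Walk n m S u u 0
  _∷_ : ∀ {u v t w k} → Adj n m S u v w → Walk n m S v t k →
        Walk n m S u t (w + k)

IsDist : ℕ → ℕ → SubsetPts → Point → Point → ℕ → Set
IsDist n m S p q d = Walk n m S p q d × (∀ k → Walk n m S p q k → d ≤ k)

_≺_ : Point → Point → Set
(x , y) ≺ (x' , y') = x < x' × y < y'

Rect : SubsetPts → ℕ → ℕ → ℕ → ℕ → Point → Set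
Rect S a b c d (u , v) = S u v ≡ true × a ≤ u × u < b × c ≤ v × v < d

-- A chain in T, represented as a list of its elements; pairwise
-- comparability forces the elements to be distinct, so size = length.
IsChainIn : (Point → Set) → List Point → Set
IsChainIn T c = All T c × AllPairs (λ a b → (a ≺ b) ⊎ (b ≺ a)) c

IsLIS : (Point → Set) → ℕ → Set
IsLIS T k = (Σ[ c ∈ List Point ] (IsChainIn T c × length c ≡ k))
          × (∀ c → IsChainIn T c → length c ≤ k)

-- Measured from the corner (x , y), the point (i + x , j + y) is at distance gap i j = i + j − 2 lis i j,
-- where lis i j is the longest chain of S in the box between them.  Walks following the recursion for
-- lis attain this weight.  Conversely, take the potential equal to gap in the quadrant above (x , y) and
-- to the skew ∣ (a − x) − (b − y) ∣ elsewhere: both agree on the boundary of the quadrant and change by at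
-- most the weight of any edge, so no walk from (x , y) is lighter than the potential at its end.  The
-- skew is also exact towards the lower right, and the two remaining cases follow by symmetry.
module Submission where

open import Defs
open import Data.Nat using (ℕ; zero; suc; _+_; _*_; _∸_; _⊔_; _≤_; _<_; _≥_; ∣_-_∣; z≤n; s≤s; _≤?_)
open import Data.Nat.Properties
open import Data.Nat.Tactic.RingSolver using (solve-∀)
open import Data.Bool using (true; false; if_then_else_)
open import Data.Empty using (⊥-elim)
open import Data.Product using (_×_; _,_; Σ-syntax)
open import Data.Sum as Sum using (_⊎_; inj₁; inj₂)
open import Data.List using (List; []; _∷_; length)
open import Data.List.Relation.Unary.All as All using (All; []; _∷_)
open import Data.List.Relation.Unary.AllPairs using (AllPairs; []; _∷_)
open import Function using (id)
open import Relation.Binary.Definitions using (Transitive)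
open import Relation.Binary.PropositionalEquality
open import Relation.Nullary using (yes; no)

m≤n⇒∃[o]o+m≡n : ∀ {m n} → m ≤ n → Σ[ o ∈ ℕ ] o + m ≡ n
m≤n⇒∃[o]o+m≡n m≤n = _ , m∸n+n≡m m≤n

≤-stepwise : ∀ (f : ℕ → ℕ) → (∀ k → f k ≤ f (suc k)) → ∀ {m n} → m ≤ n → f m ≤ f n
≤-stepwise f step {m} m≤n with m≤n⇒∃[o]o+m≡n m≤n
... | o , refl = go o
  where
    go : ∀ o → f m ≤ f (o + m)
    go zero    = ≤-refl
    go (suc o) = ≤-trans (go o) (step (o + m))

∣m+n-n∣≡m : ∀ m n → ∣ m + n - n ∣ ≡ m
∣m+n-n∣≡m m n = trans (∣-∣-comm (m + n) n) (trans (cong (∣ n -_∣) (+-comm m n)) (∣m-m+n∣≡n n m))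

∣m-1+m∣≡1 : ∀ m → ∣ m - suc m ∣ ≡ 1
∣m-1+m∣≡1 zero    = refl
∣m-1+m∣≡1 (suc m) = ∣m-1+m∣≡1 m

∣1+m-m∣≡1 : ∀ m → ∣ suc m - m ∣ ≡ 1
∣1+m-m∣≡1 m = trans (∣-∣-comm (suc m) m) (∣m-1+m∣≡1 m)

∣∣m-n∣-∣1+m-n∣∣≤1 : ∀ m n → ∣ ∣ m - n ∣ - ∣ suc m - n ∣ ∣ ≤ 1
∣∣m-n∣-∣1+m-n∣∣≤1 m       zero    rewrite ∣-∣-identityʳ m = ≤-reflexive (∣m-1+m∣≡1 m)
∣∣m-n∣-∣1+m-n∣∣≤1 zero    (suc n) = ≤-reflexive (∣1+m-m∣≡1 n)
∣∣m-n∣-∣1+m-n∣∣≤1 (suc m) (suc n) = ∣∣m-n∣-∣1+m-n∣∣≤1 m n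

∣∣m-n∣-∣m-1+n∣∣≤1 : ∀ m n → ∣ ∣ m - n ∣ - ∣ m - suc n ∣ ∣ ≤ 1
∣∣m-n∣-∣m-1+n∣∣≤1 m n =
  subst₂ (λ s t → ∣ s - t ∣ ≤ 1) (∣-∣-comm n m) (∣-∣-comm (suc n) m) (∣∣m-n∣-∣1+m-n∣∣≤1 n m)

-- The invariant g + 2 * d ≡ t links a walk weight g, a chain length d and the semi-perimeter t of a box.

+-2*-suc : ∀ g d → g + 2 * suc d ≡ suc (suc g) + 2 * d
+-2*-suc = solve-∀

balance-suc : ∀ {g g' d t} → g + 2 * d ≡ t → g' + 2 * d ≡ suc t → g' ≡ suc g
balance-suc {g} {g'} {d} e e' = +-cancelʳ-≡ (2 * d) g' (suc g) (trans e' (cong suc (sym e)))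

balance-pred : ∀ {g g' d t} → g + 2 * d ≡ t → g' + 2 * suc d ≡ suc t → g ≡ suc g'
balance-pred {g} {g'} {d} e e' =
  suc-injective (+-cancelʳ-≡ (2 * d) (suc g) (suc (suc g'))
    (trans (cong suc e) (trans (sym e') (+-2*-suc g' d))))

balance-diag : ∀ {g g' d t} → g + 2 * d ≡ t → g' + 2 * suc d ≡ suc (suc t) → g' ≡ g
balance-diag {g} {g'} {d} e e' =
  suc-injective (suc-injective (+-cancelʳ-≡ (2 * d) (suc (suc g')) (suc (suc g))
    (trans (sym (+-2*-suc g' d)) (trans e' (cong (λ t → suc (suc t)) (sym e))))))

IsLIS-unique : ∀ {T : Point → Set} {k l} → IsLIS T k → IsLIS T l → k ≡ l
IsLIS-unique ((c , chain , refl) , k-max) ((c' , chain' , refl) , l-max) =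
  ≤-antisym (l-max c chain) (k-max c' chain')

IsChainIn-mono : ∀ {T T' : Point → Set} → (∀ {p} → T p → T' p) → ∀ {c} → IsChainIn T c → IsChainIn T' c
IsChainIn-mono T⊆T' (inT , pairs) = All.map T⊆T' inT , pairs

Rect-mono : ∀ {S x a a' y b b'} → a ≤ a' → b ≤ b' → ∀ {p} → Rect S x a y b p → Rect S x a' y b' p
Rect-mono a≤a' b≤b' (s , x≤u , u<a , y≤v , v<b) = s , x≤u , ≤-trans u<a a≤a' , y≤v , ≤-trans v<b b≤b'

≺-trans : Transitive _≺_
≺-trans (a<b , c<d) (b<e , d<f) = <-trans a<b b<e , <-trans c<d d<f

module InsertionSort {A : Set} {_<_ : A → A → Set} (<-trans : Transitive _<_) where

  Comparable : A → A → Set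
  Comparable p q = p < q ⊎ q < p

  _>_ : A → A → Set
  p > q = q < p

  Descending : List A → Set
  Descending = AllPairs _>_

  insert : (p : A) (l : List A) → All (Comparable p) l → List A
  insert p []      []              = p ∷ []
  insert p (q ∷ l) (inj₁ p<q ∷ ps) = q ∷ insert p l ps
  insert p (q ∷ l) (inj₂ q<p ∷ ps) = p ∷ q ∷ l

  All-insert : ∀ {P : A → Set} {p l} ps → P p → All P l → All P (insert p l ps)
  All-insert []            Pp []        = Pp ∷ []
  All-insert (inj₁ _ ∷ ps) Pp (Pq ∷ Pl) = Pq ∷ All-insert ps Pp Pl
  All-insert (inj₂ _ ∷ ps) Pp Pl        = Pp ∷ Pl

  length-insert : ∀ {p l} ps → length (insert p l ps) ≡ suc (length l)
  length-insert []            = refl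
  length-insert (inj₁ _ ∷ ps) = cong suc (length-insert ps)
  length-insert (inj₂ _ ∷ ps) = refl

  insert-descending : ∀ {p l} ps → Descending l → Descending (insert p l ps)
  insert-descending []              []               = [] ∷ []
  insert-descending (inj₁ p<q ∷ ps) (q>l ∷ desc)     = All-insert ps p<q q>l ∷ insert-descending ps desc
  insert-descending (inj₂ q<p ∷ ps) desc@(q>l ∷ _) = (q<p ∷ All.map (λ r<q → <-trans r<q q<p) q>l) ∷ desc

  sort : (c : List A) → AllPairs Comparable c → List A
  All-sort : ∀ {P : A → Set} {c} (pairs : AllPairs Comparable c) → All P c → All P (sort c pairs)

  sort []      []           = []
  sort (p ∷ c) (ps ∷ pairs) = insert p (sort c pairs) (All-sort pairs ps)

  All-sort []          []        = []
  All-sort (_ ∷ pairs) (Pp ∷ Pc) = All-insert _ Pp (All-sort pairs Pc)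

  length-sort : ∀ {c} (pairs : AllPairs Comparable c) → length (sort c pairs) ≡ length c
  length-sort []           = refl
  length-sort (ps ∷ pairs) = trans (length-insert (All-sort pairs ps)) (cong suc (length-sort pairs))

  sort-descending : ∀ {c} (pairs : AllPairs Comparable c) → Descending (sort c pairs)
  sort-descending []          = []
  sort-descending (_ ∷ pairs) = insert-descending _ (sort-descending pairs)

open InsertionSort {_<_ = _≺_} ≺-trans

module LIS (S : SubsetPts) (x y : ℕ) where

  Box : ℕ → ℕ → Point → Set
  Box i j = Rect S x (i + x) y (j + y)

  -- A chain in the box has at most one point in its last row and column, and the
  -- rest of the chain lies strictly below-left of that point.
  lis : ℕ → ℕ → ℕ
  lis zero    j       = 0
  lis (suc i) zero    = 0
  lis (suc i) (suc j) = if S (i + x) (j + y) then suc (lis i j) else lis i (suc j) ⊔ lis (suc i) j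

  lis-zeroʳ : ∀ i → lis i 0 ≡ 0
  lis-zeroʳ zero    = refl
  lis-zeroʳ (suc i) = refl

  lis-diag : ∀ {i j} → S (i + x) (j + y) ≡ true → lis (suc i) (suc j) ≡ suc (lis i j)
  lis-diag s rewrite s = refl

  lis-off-diag : ∀ {i j} → S (i + x) (j + y) ≡ false → lis (suc i) (suc j) ≡ lis i (suc j) ⊔ lis (suc i) j
  lis-off-diag s rewrite s = refl

  lis-monoˡ : ∀ i j → lis i j ≤ lis (suc i) j
  lis-monoʳ : ∀ i j → lis i j ≤ lis i (suc j)
  lis-stepˡ : ∀ i j → lis (suc i) j ≤ suc (lis i j)
  lis-stepʳ : ∀ i j → lis i (suc j) ≤ suc (lis i j)

  lis-monoˡ zero    j       = z≤n
  lis-monoˡ (suc i) zero    = z≤n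
  lis-monoˡ (suc i) (suc j) with S (suc i + x) (j + y)
  ... | true  = lis-stepʳ (suc i) j
  ... | false = m≤m⊔n _ _

  lis-monoʳ zero    j       = z≤n
  lis-monoʳ (suc i) zero    = z≤n
  lis-monoʳ (suc i) (suc j) with S (i + x) (suc j + y)
  ... | true  = lis-stepˡ i (suc j)
  ... | false = m≤n⊔m _ _

  lis-stepˡ i zero    = z≤n
  lis-stepˡ i (suc j) with S (i + x) (j + y)
  ... | true  = s≤s (lis-monoʳ i j)
  ... | false = ⊔-lub (n≤1+n _) (≤-trans (lis-stepˡ i j) (s≤s (lis-monoʳ i j)))

  lis-stepʳ zero    j = z≤n
  lis-stepʳ (suc i) j with S (i + x) (j + y)
  ... | true  = s≤s (lis-monoˡ i j)
  ... | false = ⊔-lub (≤-trans (lis-stepʳ i j) (s≤s (lis-monoˡ i j))) (n≤1+n _)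

  lis-mono : ∀ {i i' j j'} → i ≤ i' → j ≤ j' → lis i j ≤ lis i' j'
  lis-mono {i' = i'} {j = j} i≤i' j≤j' =
    ≤-trans (≤-stepwise (λ k → lis k j) (λ k → lis-monoˡ k j) i≤i') (≤-stepwise (lis i') (lis-monoʳ i') j≤j')

  lis-≤ˡ : ∀ i j → lis i j ≤ i
  lis-≤ˡ zero    j = z≤n
  lis-≤ˡ (suc i) j = ≤-trans (lis-stepˡ i j) (s≤s (lis-≤ˡ i j))

  lis-≤ʳ : ∀ i j → lis i j ≤ j
  lis-≤ʳ i zero    = ≤-reflexive (lis-zeroʳ i)
  lis-≤ʳ i (suc j) = ≤-trans (lis-stepʳ i j) (s≤s (lis-≤ʳ i j))

  Box-below-corner : ∀ {i j p} → Box i j p → p ≺ (i + x , j + y)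
  Box-below-corner (_ , _ , u<i+x , _ , v<j+y) = u<i+x , v<j+y

  lis-chain : ∀ i j → Σ[ c ∈ List Point ] (IsChainIn (Box i j) c × length c ≡ lis i j)
  lis-chain zero    j       = [] , ([] , []) , refl
  lis-chain (suc i) zero    = [] , ([] , []) , refl
  lis-chain (suc i) (suc j) with S (i + x) (j + y) in s
  ... | true =
    let c , (inBox , pairs) , len = lis-chain i j in
    (i + x , j + y) ∷ c ,
    ((s , m≤n+m x i , ≤-refl , m≤n+m y j , ≤-refl) ∷ All.map (Rect-mono {S} (n≤1+n _) (n≤1+n _)) inBox ,
     All.map (λ r → inj₂ (Box-below-corner r)) inBox ∷ pairs) ,
    cong suc len
  ... | false with ⊔-sel (lis i (suc j)) (lis (suc i) j)
  ...   | inj₁ e =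
    let c , chain , len = lis-chain i (suc j) in
    c , IsChainIn-mono (Rect-mono {S} (n≤1+n _) ≤-refl) chain , trans len (sym e)
  ...   | inj₂ e =
    let c , chain , len = lis-chain (suc i) j in
    c , IsChainIn-mono (Rect-mono {S} ≤-refl (n≤1+n _)) chain , trans len (sym e)

  descending-bound : ∀ i j {c} → All (Box i j) c → Descending c → length c ≤ lis i j
  descending-bound i j [] [] = z≤n
  descending-bound i j {(u , v) ∷ c} ((s , x≤u , u<i+x , y≤v , v<j+y) ∷ inBox) (below ∷ desc)
    with m≤n⇒∃[o]o+m≡n x≤u | m≤n⇒∃[o]o+m≡n y≤v
  ... | k , refl | l , refl = begin
    suc (length c)      ≤⟨ s≤s (descending-bound k l (All.zipWith narrow (below , inBox)) desc) ⟩
    suc (lis k l)       ≡⟨ sym (lis-diag s) ⟩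
    lis (suc k) (suc l) ≤⟨ lis-mono (+-cancelʳ-≤ x (suc k) i u<i+x) (+-cancelʳ-≤ y (suc l) j v<j+y) ⟩
    lis i j             ∎
    where
      open ≤-Reasoning
      narrow : ∀ {r} → r ≺ (k + x , l + y) × Box i j r → Box k l r
      narrow ((u'<k+x , v'<l+y) , (s' , x≤u' , _ , y≤v' , _)) = s' , x≤u' , u'<k+x , y≤v' , v'<l+y

  lis-isLIS : ∀ i j → IsLIS (Box i j) (lis i j)
  lis-isLIS i j = lis-chain i j , λ c (inBox , pairs) →
    subst (_≤ lis i j) (length-sort pairs) (descending-bound i j (All-sort pairs inBox) (sort-descending pairs))

  gap : ℕ → ℕ → ℕ
  gap i j = i + j ∸ 2 * lis i j

  gap-balance : ∀ i j → gap i j + 2 * lis i j ≡ i + j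
  gap-balance i j = m∸n+n≡m (+-mono-≤ (lis-≤ˡ i j) (≤-trans (≤-reflexive (+-identityʳ _)) (lis-≤ʳ i j)))

  gap-zeroʳ : ∀ i → gap i 0 ≡ i
  gap-zeroʳ i rewrite lis-zeroʳ i = +-identityʳ i

  gap-suc : ∀ {i j i' j'} → lis i' j' ≡ lis i j → i' + j' ≡ suc (i + j) → gap i' j' ≡ suc (gap i j)
  gap-suc {i} {j} {i'} {j'} same grow =
    balance-suc {d = lis i j} (gap-balance i j)
      (trans (cong (λ d → gap i' j' + 2 * d) (sym same)) (trans (gap-balance i' j') grow))

  gap-pred : ∀ {i j i' j'} → lis i' j' ≡ suc (lis i j) → i' + j' ≡ suc (i + j) → gap i j ≡ suc (gap i' j')
  gap-pred {i} {j} {i'} {j'} more grow =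
    balance-pred {d = lis i j} (gap-balance i j)
      (trans (cong (λ d → gap i' j' + 2 * d) (sym more)) (trans (gap-balance i' j') grow))

  gap-diag : ∀ {i j} → S (i + x) (j + y) ≡ true → gap (suc i) (suc j) ≡ gap i j
  gap-diag {i} {j} s =
    balance-diag {d = lis i j} (gap-balance i j)
      (trans (cong (λ d → gap (suc i) (suc j) + 2 * d) (sym (lis-diag s)))
             (trans (gap-balance (suc i) (suc j)) (cong suc (+-suc i j))))

  gap-unit-step : ∀ {i j i' j'} → i' + j' ≡ suc (i + j) → lis i j ≤ lis i' j' → lis i' j' ≤ suc (lis i j) →
                  ∣ gap i j - gap i' j' ∣ ≤ 1
  gap-unit-step {i} {j} {i'} {j'} grow lo hi with m≤n⇒m<n∨m≡n lo
  ... | inj₁ lt = ≤-reflexive (begin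
    ∣ gap i j - gap i' j' ∣         ≡⟨ cong ∣_- gap i' j' ∣ (gap-pred {i} {j} {i'} {j'} (≤-antisym hi lt) grow) ⟩
    ∣ suc (gap i' j') - gap i' j' ∣ ≡⟨ ∣1+m-m∣≡1 (gap i' j') ⟩
    1                               ∎)
    where open ≡-Reasoning
  ... | inj₂ same = ≤-reflexive (begin
    ∣ gap i j - gap i' j' ∣     ≡⟨ cong ∣ gap i j -_∣ (gap-suc {i} {j} {i'} {j'} (sym same) grow) ⟩
    ∣ gap i j - suc (gap i j) ∣ ≡⟨ ∣m-1+m∣≡1 (gap i j) ⟩
    1                           ∎)
    where open ≡-Reasoning

  gap-boundary : ∀ {i j} → i ≡ 0 ⊎ j ≡ 0 → gap i j ≡ ∣ i - j ∣
  gap-boundary     (inj₁ refl) = refl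
  gap-boundary {i} (inj₂ refl) = trans (gap-zeroʳ i) (sym (∣-∣-identityʳ i))

module Walks (n m : ℕ) (S : SubsetPts) where

  flipAdj : ∀ {u v w} → Adj n m S u v w → Adj n m S v u w
  flipAdj (fwd e) = bwd e
  flipAdj (bwd e) = fwd e

  _++ʷ_ : ∀ {u v t k l} → Walk n m S u v k → Walk n m S v t l → Walk n m S u t (k + l)
  []                        ++ʷ W = W
  (_∷_ {w = w} {k = k} e V) ++ʷ W = subst (Walk n m S _ _) (sym (+-assoc w k _)) (e ∷ (V ++ʷ W))

  _▷_ : ∀ {u v t k w} → Walk n m S u v k → Adj n m S v t w → Walk n m S u t (k + w)
  _▷_ {k = k} {w} W e = subst (Walk n m S _ _) (cong (k +_) (+-identityʳ w)) (W ++ʷ (e ∷ []))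

  reverse : ∀ {u v k} → Walk n m S u v k → Walk n m S v u k
  reverse []                        = []
  reverse (_∷_ {w = w} {k = k} e W) = subst (Walk n m S _ _) (+-comm k w) (reverse W ▷ flipAdj e)

  IsDist-sym : ∀ {p q d} → IsDist n m S p q d → IsDist n m S q p d
  IsDist-sym (W , minimal) = reverse W , λ k W' → minimal k (reverse W')

  horizontal-walk : ∀ i {a b} → i + a ≤ n → b ≤ m → Walk n m S (a , b) (i + a , b) i
  horizontal-walk zero    _       _   = []
  horizontal-walk (suc i) i+a<n b≤m =
    subst (Walk n m S _ _) (+-comm i 1) (horizontal-walk i (<⇒≤ i+a<n) b≤m ▷ fwd (horiz i+a<n b≤m))

  vertical-walk : ∀ j {a b} → a ≤ n → j + b ≤ m → Walk n m S (a , b) (a , j + b) j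
  vertical-walk zero    _   _       = []
  vertical-walk (suc j) a≤n j+b<m =
    subst (Walk n m S _ _) (+-comm j 1) (vertical-walk j a≤n (<⇒≤ j+b<m) ▷ fwd (vert a≤n j+b<m))

  Lipschitz : (Point → ℕ) → Set
  Lipschitz f = ∀ {u v w} → Edge n m S u v w → ∣ f u - f v ∣ ≤ w

  walk-lipschitz : ∀ f → Lipschitz f → ∀ {u t k} → Walk n m S u t k → ∣ f u - f t ∣ ≤ k
  walk-lipschitz f L []                            = ≤-reflexive (∣n-n∣≡0 (f _))
  walk-lipschitz f L (_∷_ {u} {v} {t} {w} {k} e W) =
    ≤-trans (∣-∣-triangle (f u) (f v) (f t)) (+-mono-≤ (adjacent e) (walk-lipschitz f L W))
    where
      adjacent : Adj n m S u v w → ∣ f u - f v ∣ ≤ w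
      adjacent (fwd e) = L e
      adjacent (bwd e) = subst (_≤ w) (∣-∣-comm (f v) (f u)) (L e)

module Potential (n m : ℕ) (S : SubsetPts) (x y : ℕ) where
  open LIS S x y
  open Walks n m S

  skew : Point → ℕ
  skew (a , b) = ∣ a + y - b + x ∣

  skew-inside : ∀ i j → skew (i + x , j + y) ≡ ∣ i - j ∣
  skew-inside i j = trans (cong₂ ∣_-_∣ (shift i x y) (trans (shift j y x) (cong (_+ j) (+-comm y x))))
                          (∣m+n-m+o∣≡∣n-o∣ (x + y) i j)
    where
      shift : ∀ i a b → i + a + b ≡ a + b + i
      shift = solve-∀

  skew-lipschitz : Lipschitz skew
  skew-lipschitz (horiz {a} {b} _ _)  = ∣∣m-n∣-∣1+m-n∣∣≤1 (a + y) (b + x)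
  skew-lipschitz (vert {a} {b} _ _)   = ∣∣m-n∣-∣m-1+n∣∣≤1 (a + y) (b + x)
  skew-lipschitz (diag {a} {b} _ _ _) = ≤-reflexive (∣n-n∣≡0 (skew (a , b)))

  potential : Point → ℕ
  potential (a , b) with x ≤? a | y ≤? b
  ... | yes _ | yes _ = gap (a ∸ x) (b ∸ y)
  ... | _     | _     = skew (a , b)

  data Quadrant : Point → Set where
    inside  : ∀ i j → Quadrant (i + x , j + y)
    outside : ∀ {a b} → a < x ⊎ b < y → Quadrant (a , b)

  quadrant : ∀ p → Quadrant p
  quadrant (a , b) with x ≤? a | y ≤? b
  ... | yes x≤a | yes y≤b = subst Quadrant (cong₂ _,_ (m∸n+n≡m x≤a) (m∸n+n≡m y≤b)) (inside _ _)
  ... | no  x≰a | _       = outside (inj₁ (≰⇒> x≰a))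
  ... | yes _   | no  y≰b = outside (inj₂ (≰⇒> y≰b))

  Below : Point → Set
  Below (a , b) = a ≤ x ⊎ b ≤ y

  potential-inside : ∀ i j → potential (i + x , j + y) ≡ gap i j
  potential-inside i j with x ≤? i + x | y ≤? j + y
  ... | yes _ | yes _   = cong₂ gap (m+n∸n≡m i x) (m+n∸n≡m j y)
  ... | no  x≰ | _      = ⊥-elim (x≰ (m≤n+m x i))
  ... | yes _ | no  y≰  = ⊥-elim (y≰ (m≤n+m y j))

  potential-outside : ∀ {a b} → a < x ⊎ b < y → potential (a , b) ≡ skew (a , b)
  potential-outside {a} {b} a<x⊎b<y with x ≤? a | y ≤? b | a<x⊎b<y
  ... | no _    | _       | _        = refl
  ... | yes _   | no _    | _        = refl
  ... | yes x≤a | yes _   | inj₁ a<x = ⊥-elim (<⇒≱ a<x x≤a)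
  ... | yes _   | yes y≤b | inj₂ b<y = ⊥-elim (<⇒≱ b<y y≤b)

  potential-below : ∀ p → Below p → potential p ≡ skew p
  potential-below p below with quadrant p
  ... | outside a<x⊎b<y = potential-outside a<x⊎b<y
  ... | inside i j      =
    trans (potential-inside i j) (trans (gap-boundary (Sum.map i≡0 j≡0 below)) (sym (skew-inside i j)))
    where
      i≡0 : i + x ≤ x → i ≡ 0
      i≡0 le = n≤0⇒n≡0 (+-cancelʳ-≤ x i 0 le)
      j≡0 : j + y ≤ y → j ≡ 0
      j≡0 le = n≤0⇒n≡0 (+-cancelʳ-≤ y j 0 le)

  edge-from-outside : ∀ {a b v w} → a < x ⊎ b < y → Edge n m S (a , b) v w → Below v
  edge-from-outside a<x⊎b<y (horiz _ _)  = Sum.map id <⇒≤ a<x⊎b<y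
  edge-from-outside a<x⊎b<y (vert _ _)   = Sum.map <⇒≤ id a<x⊎b<y
  edge-from-outside a<x⊎b<y (diag _ _ _) = a<x⊎b<y

  edge-from-inside : ∀ {i j v w} → Edge n m S (i + x , j + y) v w →
                     ∣ potential (i + x , j + y) - potential v ∣ ≤ w
  edge-from-inside {i} {j} (horiz _ _) =
    subst₂ (λ s t → ∣ s - t ∣ ≤ 1) (sym (potential-inside i j)) (sym (potential-inside (suc i) j))
           (gap-unit-step {i} {j} {suc i} {j} refl (lis-monoˡ i j) (lis-stepˡ i j))
  edge-from-inside {i} {j} (vert _ _) =
    subst₂ (λ s t → ∣ s - t ∣ ≤ 1) (sym (potential-inside i j)) (sym (potential-inside i (suc j)))
           (gap-unit-step {i} {j} {i} {suc j} (+-suc i j) (lis-monoʳ i j) (lis-stepʳ i j))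
  edge-from-inside {i} {j} (diag _ _ s) = ≤-reflexive (begin
    ∣ potential (i + x , j + y) - potential (suc i + x , suc j + y) ∣
      ≡⟨ cong₂ ∣_-_∣ (potential-inside i j) (potential-inside (suc i) (suc j)) ⟩
    ∣ gap i j - gap (suc i) (suc j) ∣ ≡⟨ cong ∣ gap i j -_∣ (gap-diag s) ⟩
    ∣ gap i j - gap i j ∣             ≡⟨ ∣n-n∣≡0 (gap i j) ⟩
    0                                 ∎)
    where open ≡-Reasoning

  potential-lipschitz : Lipschitz potential
  potential-lipschitz {a , b} e with quadrant (a , b)
  ... | inside i j = edge-from-inside e
  ... | outside a<x⊎b<y =
    subst₂ (λ s t → ∣ s - t ∣ ≤ _)
           (sym (potential-below (a , b) (Sum.map <⇒≤ <⇒≤ a<x⊎b<y)))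
           (sym (potential-below _ (edge-from-outside a<x⊎b<y e)))
           (skew-lipschitz e)

  potential-≤-weight : ∀ {p k} → Walk n m S (x , y) p k → potential p ≤ k
  potential-≤-weight {p} {k} W =
    subst (λ z → ∣ z - potential p ∣ ≤ k) (potential-inside 0 0) (walk-lipschitz potential potential-lipschitz W)

  -- Follow the maximum in the recursion for lis backwards.
  reach : ∀ i j → i + x ≤ n → j + y ≤ m → Walk n m S (x , y) (i + x , j + y) (gap i j)
  reach zero    j       x≤n   j+y≤m = vertical-walk j x≤n j+y≤m
  reach (suc i) zero    i+x<n y≤m   =
    subst (Walk n m S _ _) (sym (gap-zeroʳ (suc i))) (horizontal-walk (suc i) i+x<n y≤m)
  reach (suc i) (suc j) i+x<n j+y<m = extend (S (i + x) (j + y)) refl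
    where
      extend : ∀ b → S (i + x) (j + y) ≡ b → Walk n m S (x , y) (suc i + x , suc j + y) (gap (suc i) (suc j))
      extend true s =
        subst (Walk n m S _ _) (trans (+-identityʳ _) (sym (gap-diag s)))
              (reach i j (<⇒≤ i+x<n) (<⇒≤ j+y<m) ▷ fwd (diag i+x<n j+y<m s))
      extend false s with ⊔-sel (lis i (suc j)) (lis (suc i) j)
      ... | inj₁ e =
        subst (Walk n m S _ _) (trans (+-comm _ 1) (sym (gap-suc {i} {suc j} (trans (lis-off-diag s) e) refl)))
              (reach i (suc j) (<⇒≤ i+x<n) j+y<m ▷ fwd (horiz i+x<n j+y<m))
      ... | inj₂ e =
        subst (Walk n m S _ _)
              (trans (+-comm _ 1) (sym (gap-suc {suc i} {j} (trans (lis-off-diag s) e) (cong suc (+-suc i j)))))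
              (reach (suc i) j i+x<n (<⇒≤ j+y<m) ▷ fwd (vert i+x<n j+y<m))

  quadrant-isDist : ∀ i j → i + x ≤ n → j + y ≤ m → IsDist n m S (x , y) (i + x , j + y) (gap i j)
  quadrant-isDist i j i+x≤n j+y≤m =
    reach i j i+x≤n j+y≤m , λ k W → subst (_≤ k) (potential-inside i j) (potential-≤-weight W)

quadrant-distance : ∀ n m S x y x' y' → x ≤ x' → y ≤ y' → x' ≤ n → y' ≤ m →
  (L : ℕ) → IsLIS (Rect S x x' y y') L →
  Σ[ d ∈ ℕ ] (d + 2 * L ≡ ∣ x' - x ∣ + ∣ y' - y ∣ × IsDist n m S (x , y) (x' , y') d)
quadrant-distance n m S x y x' y' x≤x' y≤y' x'≤n y'≤m L isLIS
  with m≤n⇒∃[o]o+m≡n x≤x' | m≤n⇒∃[o]o+m≡n y≤y'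
... | i , refl | j , refl = gap i j , balance , quadrant-isDist i j x'≤n y'≤m
  where
    open LIS S x y
    open Potential n m S x y
    open ≡-Reasoning
    balance : gap i j + 2 * L ≡ ∣ i + x - x ∣ + ∣ j + y - y ∣
    balance = begin
      gap i j + 2 * L          ≡⟨ cong (λ l → gap i j + 2 * l) (IsLIS-unique isLIS (lis-isLIS i j)) ⟩
      gap i j + 2 * lis i j    ≡⟨ gap-balance i j ⟩
      i + j                    ≡⟨ sym (cong₂ _+_ (∣m+n-n∣≡m i x) (∣m+n-n∣≡m j y)) ⟩
      ∣ i + x - x ∣ + ∣ j + y - y ∣ ∎

lower-right-distance : ∀ n m S x y x' y' → x ≤ x' → y' ≤ y → x' ≤ n → y ≤ m →
  IsDist n m S (x , y) (x' , y') (∣ x' - x ∣ + ∣ y' - y ∣)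
lower-right-distance n m S x y x' y' x≤x' y'≤y x'≤n y≤m
  with m≤n⇒∃[o]o+m≡n x≤x' | m≤n⇒∃[o]o+m≡n y'≤y
... | i , refl | j , refl = subst (IsDist n m S _ _) (sym weight) (walk , minimal)
  where
    open Walks n m S
    open Potential n m S x (j + y')
    rearrange : ∀ i x j y' → i + x + (j + y') ≡ i + j + (y' + x)
    rearrange = solve-∀
    weight : ∣ i + x - x ∣ + ∣ y' - j + y' ∣ ≡ i + j
    weight = cong₂ _+_ (∣m+n-n∣≡m i x) (trans (∣-∣-comm y' (j + y')) (∣m+n-n∣≡m j y'))
    walk : Walk n m S (x , j + y') (i + x , y') (i + j)
    walk = horizontal-walk i x'≤n y≤m ++ʷ reverse (vertical-walk j x'≤n y≤m)
    skew-target : skew (i + x , y') ≡ i + j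
    skew-target = trans (cong (∣_- y' + x ∣) (rearrange i x j y')) (∣m+n-n∣≡m (i + j) (y' + x))
    minimal : ∀ k → Walk n m S (x , j + y') (i + x , y') k → i + j ≤ k
    minimal k W =
      subst (_≤ k) (trans (potential-below _ (inj₂ (m≤n+m y' j))) skew-target) (potential-≤-weight W)

lemma3p11 : (n m : ℕ) (S : SubsetPts) →
    (∀ a b → S a b ≡ true → a < n × b < m) →
    (x y x' y' : ℕ) → x ≤ n → y ≤ m → x' ≤ n → y' ≤ m →
    ((x ≤ x' → y ≤ y' → (L : ℕ) → IsLIS (Rect S x x' y y') L →
        Σ[ d ∈ ℕ ] (d + 2 * L ≡ ∣ x' - x ∣ + ∣ y' - y ∣ × IsDist n m S (x , y) (x' , y') d))
    × (x ≤ x' → y ≥ y' → IsDist n m S (x , y) (x' , y') (∣ x' - x ∣ + ∣ y' - y ∣))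
    × (x ≥ x' → y ≤ y' → IsDist n m S (x , y) (x' , y') (∣ x' - x ∣ + ∣ y' - y ∣))
    × (x ≥ x' → y ≥ y' → (L : ℕ) → IsLIS (Rect S x' x y' y) L →
        Σ[ d ∈ ℕ ] (d + 2 * L ≡ ∣ x' - x ∣ + ∣ y' - y ∣ × IsDist n m S (x , y) (x' , y') d)))
lemma3p11 n m S _ x y x' y' x≤n y≤m x'≤n y'≤m =
    (λ x≤x' y≤y' → quadrant-distance n m S x y x' y' x≤x' y≤y' x'≤n y'≤m)
  , (λ x≤x' y'≤y → lower-right-distance n m S x y x' y' x≤x' y'≤y x'≤n y≤m)
  , (λ x'≤x y≤y' → subst (IsDist n m S _ _) swap
                      (IsDist-sym (lower-right-distance n m S x' y' x y x'≤x y≤y' x≤n y'≤m)))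
  , λ x'≤x y'≤y L isLIS →
      let d , balance , isDist = quadrant-distance n m S x' y' x y x'≤x y'≤y x≤n y≤m L isLIS
      in d , trans balance swap , IsDist-sym isDist
  where
    open Walks n m S
    swap : ∣ x - x' ∣ + ∣ y - y' ∣ ≡ ∣ x' - x ∣ + ∣ y' - y ∣
    swap = cong₂ _+_ (∣-∣-comm x x') (∣-∣-comm y y')
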